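{- Let $1\le k<n$ and let $b=b_{k+1}\ldots b_n$ be an admissible suffix in $R_n$. Then $\alpha_R(b)=\{k-1\}$ if $\mu_R(b)=k$, or if $\mu_R(b)=k-1$ and $b_{k+1}<k-1$; $\alpha_R(b)=\{0,1,\ldots,k-1\}$ if $\mu_R(b)=k-1$ and $b_{k+1}=k-1$, or if $\mu_R(b)<k-1$. Moreover, for the empty suffix, $\alpha_R(\epsilon)=\{0,1,\ldots,n-1\}$.
   Context: $R_n$ is the set of sequences $s_1\ldots s_n$ of non-negative integers with $s_1=0$ and $0\le s_{k+1}\le\max(s_1,\ldots,s_k)+1$ for $1\le k<n$. A word $b=b_{k+1}\ldots b_n$ is an admissible suffix in $R_n$ if some sequence of $R_n$ ends with $b$. For such $b$ (with $1\le k<n$): $\alpha_R(b)=\{x : xb \text{ is an admissible suffix in } R_n\}$, and $\mu_R(b)=\min\{\max(s_1,\ldots,s_k,b_{k+1}) : s_1\ldots s_kb\in R_n\}$. For the empty suffix $\epsilon$, $\alpha_R(\epsilon)$ is defined as $\{0,\ldots,n-1\}$. -}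

module Defs where

open import Data.Nat using (ℕ; zero; suc; _≤_; _<_; _⊔_)
open import Data.List using (List; []; _∷_; _++_; length; foldr)
open import Data.Product using (Σ; _×_)
open import Data.Unit using (⊤)
open import Relation.Binary.PropositionalEquality using (_≡_)

RGFrom : ℕ → List ℕ → Set
RGFrom m []       = ⊤
RGFrom m (x ∷ xs) = x ≤ suc m × RGFrom (m ⊔ x) xs

IsRG : List ℕ → Set
IsRG []       = ⊤
IsRG (x ∷ xs) = x ≡ 0 × RGFrom x xs

InR : ℕ → List ℕ → Set
InR n s = length s ≡ n × IsRG s

Admissible : ℕ → List ℕ → Set
Admissible n b = Σ (List ℕ) (λ p → InR n (p ++ b))

alphaR : ℕ → List ℕ → ℕ → Set
alphaR n []      x = x < n
alphaR n (c ∷ b) x = Admissible n (x ∷ c ∷ b)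

maxL : List ℕ → ℕ
maxL = foldr _⊔_ 0

IsMuR : ℕ → ℕ → List ℕ → ℕ → Set
IsMuR n b₁ b' m =
  Σ (List ℕ) (λ p → InR n (p ++ b₁ ∷ b') × maxL (p ++ b₁ ∷ []) ≡ m)
  × ((p : List ℕ) → InR n (p ++ b₁ ∷ b') → m ≤ maxL (p ++ b₁ ∷ []))

-- A prefix P of length k can precede b = b₁ b' exactly when P is itself a restricted growth
-- word, b₁ ≤ max P + 1, and max(P, b₁) ≥ μ_R(b): the tail b' only constrains the running
-- maximum it starts from, and a prefix realising μ shows that μ is already large enough.
-- A prefix q x with x < k − 1 has maximum below k − 1, which is compatible with b only
-- when μ < k − 1 or μ = b₁ = k − 1; a staircase 0 1 … (k−2) x realises every other x ≤ k − 1.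
module Submission where

open import Defs
open import Data.Nat using (ℕ; zero; suc; _≤_; _<_; _∸_; _+_; _⊔_; z≤n; s≤s)
open import Data.Nat.Properties
open import Data.List using (List; []; _∷_; _++_; _∷ʳ_; length)
open import Data.List.Properties using (length-++; ∷ʳ-++)
open import Data.Product using (_×_; _,_; Σ; proj₁; proj₂)
open import Data.Sum using (_⊎_; inj₁; inj₂)
open import Data.Unit using (tt)
open import Data.Empty using (⊥-elim)
open import Function.Bundles using (_⇔_; mk⇔; Equivalence)
open import Relation.Nullary using (¬_)
open import Relation.Binary.PropositionalEquality
  using (_≡_; refl; sym; trans; cong; cong₂; subst; module ≡-Reasoning)

maxL-++ : ∀ xs ys → maxL (xs ++ ys) ≡ maxL xs ⊔ maxL ys
maxL-++ []       ys = refl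
maxL-++ (x ∷ xs) ys = trans (cong (x ⊔_) (maxL-++ xs ys)) (sym (⊔-assoc x (maxL xs) (maxL ys)))

maxL-∷ʳ : ∀ xs x → maxL (xs ∷ʳ x) ≡ maxL xs ⊔ x
maxL-∷ʳ xs x = trans (maxL-++ xs (x ∷ [])) (cong (maxL xs ⊔_) (⊔-identityʳ x))

≤-maxL-∷ʳ : ∀ xs x → x ≤ maxL (xs ∷ʳ x)
≤-maxL-∷ʳ xs x = subst (x ≤_) (sym (maxL-∷ʳ xs x)) (m≤n⊔m (maxL xs) x)

maxL-≤-maxL-∷ʳ : ∀ xs x → maxL xs ≤ maxL (xs ∷ʳ x)
maxL-≤-maxL-∷ʳ xs x = subst (maxL xs ≤_) (sym (maxL-∷ʳ xs x)) (m≤m⊔n (maxL xs) x)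

length-∷ʳ : ∀ (xs : List ℕ) x → length (xs ∷ʳ x) ≡ suc (length xs)
length-∷ʳ xs x = trans (length-++ xs) (+-comm (length xs) 1)

RGFrom-mono : ∀ {m m′} xs → m ≤ m′ → RGFrom m xs → RGFrom m′ xs
RGFrom-mono []       m≤m′ tt         = tt
RGFrom-mono (x ∷ xs) m≤m′ (x≤ , rest) = ≤-trans x≤ (s≤s m≤m′) , RGFrom-mono xs (⊔-monoˡ-≤ x m≤m′) rest

RGFrom-++⁻ : ∀ m xs ys → RGFrom m (xs ++ ys) → RGFrom m xs × RGFrom (m ⊔ maxL xs) ys
RGFrom-++⁻ m []       ys r = tt , RGFrom-mono ys (m≤m⊔n m 0) r
RGFrom-++⁻ m (x ∷ xs) ys (x≤ , r) with RGFrom-++⁻ (m ⊔ x) xs ys r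
... | rxs , rys = (x≤ , rxs) , RGFrom-mono ys (≤-reflexive (⊔-assoc m x (maxL xs))) rys

RGFrom-++⁺ : ∀ m xs ys → RGFrom m xs → RGFrom (m ⊔ maxL xs) ys → RGFrom m (xs ++ ys)
RGFrom-++⁺ m []       ys tt         rys = RGFrom-mono ys (≤-reflexive (⊔-identityʳ m)) rys
RGFrom-++⁺ m (x ∷ xs) ys (x≤ , rxs) rys =
  x≤ , RGFrom-++⁺ (m ⊔ x) xs ys rxs (RGFrom-mono ys (≤-reflexive (sym (⊔-assoc m x (maxL xs)))) rys)

RGFrom-maxL≤ : ∀ m xs → RGFrom m xs → maxL xs ≤ m + length xs
RGFrom-maxL≤ m []       tt         = z≤n
RGFrom-maxL≤ m (x ∷ xs) (x≤ , rest) = subst (maxL (x ∷ xs) ≤_) (sym (+-suc m (length xs))) (⊔-lub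
  (≤-trans x≤ (s≤s (m≤m+n m (length xs))))
  (≤-trans (RGFrom-maxL≤ (m ⊔ x) xs rest) (+-monoˡ-≤ (length xs) (⊔-lub (n≤1+n m) x≤))))

IsRG-++⁻ : ∀ p ys → 0 < length p → IsRG (p ++ ys) → IsRG p × RGFrom (maxL p) ys
IsRG-++⁻ (y ∷ ps) ys _ (y≡0 , r) with RGFrom-++⁻ y ps ys r
... | rps , rys = (y≡0 , rps) , rys

IsRG-++⁺ : ∀ p ys → 0 < length p → IsRG p → RGFrom (maxL p) ys → IsRG (p ++ ys)
IsRG-++⁺ (y ∷ ps) ys _ (y≡0 , rps) rys = y≡0 , RGFrom-++⁺ y ps ys rps rys

IsRG⇒maxL< : ∀ p → 0 < length p → IsRG p → maxL p < length p
IsRG⇒maxL< (y ∷ ps) _ (refl , r) = s≤s (RGFrom-maxL≤ 0 ps r)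

IsRG-∷ʳ⇒≤length : ∀ q x → IsRG (q ∷ʳ x) → x ≤ length q
IsRG-∷ʳ⇒≤length q x rg = ≤-pred (begin-strict
  x                  ≤⟨ ≤-maxL-∷ʳ q x ⟩
  maxL (q ∷ʳ x)      <⟨ IsRG⇒maxL< (q ∷ʳ x) 0<length rg ⟩
  length (q ∷ʳ x)    ≡⟨ length-∷ʳ q x ⟩
  suc (length q)     ∎)
  where
  open ≤-Reasoning
  0<length : 0 < length (q ∷ʳ x)
  0<length = subst (0 <_) (sym (length-∷ʳ q x)) (s≤s z≤n)

IsRG-∷ʳ⇒maxL< : ∀ q x → IsRG (q ∷ʳ x) → x < length q → maxL (q ∷ʳ x) < length q
IsRG-∷ʳ⇒maxL< q x rg x<len =
  subst (_< length q) (sym (maxL-∷ʳ q x)) (⊔-lub (IsRG⇒maxL< q 0<len (proj₁ (IsRG-++⁻ q (x ∷ []) 0<len rg))) x<len)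
  where
  0<len : 0 < length q
  0<len = ≤-trans (s≤s z≤n) x<len

staircase : ℕ → List ℕ
staircase zero    = []
staircase (suc j) = staircase j ∷ʳ j

length-staircase : ∀ j → length (staircase j) ≡ j
length-staircase zero    = refl
length-staircase (suc j) = trans (length-∷ʳ (staircase j) j) (cong suc (length-staircase j))

≤-suc-maxL-staircase : ∀ j → j ≤ suc (maxL (staircase j))
≤-suc-maxL-staircase zero    = z≤n
≤-suc-maxL-staircase (suc j) = s≤s (≤-maxL-∷ʳ (staircase j) j)

IsRG-staircase-∷ʳ : ∀ j x → x ≤ j → IsRG (staircase j ∷ʳ x)
IsRG-staircase-∷ʳ zero    zero    _   = refl , tt
IsRG-staircase-∷ʳ (suc j) x       x≤ = IsRG-++⁺ (staircase j ∷ʳ j) (x ∷ [])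
  (subst (0 <_) (sym (length-∷ʳ (staircase j) j)) (s≤s z≤n))
  (IsRG-staircase-∷ʳ j j ≤-refl)
  (≤-trans x≤ (s≤s (≤-maxL-∷ʳ (staircase j) j)) , tt)

compatible-below : ∀ {M b₁ m j} → M < j → b₁ ≤ suc M → m ≤ M ⊔ b₁ → m < j ⊎ (m ≡ j × b₁ ≡ j)
compatible-below {M} M<j b₁≤ μ≤ with m≤n⇒m<n∨m≡n (≤-trans b₁≤ M<j)
... | inj₁ b₁<j = inj₁ (≤-<-trans μ≤ (⊔-lub M<j b₁<j))
... | inj₂ refl with m≤n⇒m<n∨m≡n (subst (_ ≤_) (m≤n⇒m⊔n≡n (<⇒≤ M<j)) μ≤)
...   | inj₁ m<j = inj₁ m<j
...   | inj₂ m≡j = inj₂ (m≡j , refl)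

singleton-case-excludes : ∀ {m b₁ j} → m ≡ suc j ⊎ (m ≡ j × b₁ < j) → ¬ (m < j ⊎ (m ≡ j × b₁ ≡ j))
singleton-case-excludes (inj₁ refl)       (inj₁ m<j)        = <-asym m<j (n<1+n _)
singleton-case-excludes (inj₁ refl)       (inj₂ (m≡j , _))  = 1+n≢n m≡j
singleton-case-excludes (inj₂ (refl , _)) (inj₁ m<m)        = <-irrefl refl m<m
singleton-case-excludes (inj₂ (_ , b₁<j)) (inj₂ (_ , refl)) = <-irrefl refl b₁<j

CompatiblePrefix : ℕ → ℕ → List ℕ → Set
CompatiblePrefix m b₁ P = IsRG P × b₁ ≤ suc (maxL P) × m ≤ maxL P ⊔ b₁

-- Prefixes have length k = suc j.
module Suffix {n j b₁ m : ℕ} {b' : List ℕ} (k≤n : suc j ≤ n)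
              (length-b : length (b₁ ∷ b') ≡ n ∸ suc j) (μ : IsMuR n b₁ b' m) where

  length-prefix⁻ : ∀ P → length (P ++ b₁ ∷ b') ≡ n → length P ≡ suc j
  length-prefix⁻ P len = +-cancelʳ-≡ (n ∸ suc j) (length P) (suc j) (begin
    length P + (n ∸ suc j)         ≡⟨ cong (length P +_) length-b ⟨
    length P + length (b₁ ∷ b')    ≡⟨ length-++ P ⟨
    length (P ++ b₁ ∷ b')          ≡⟨ len ⟩
    n                              ≡⟨ m+[n∸m]≡n k≤n ⟨
    suc j + (n ∸ suc j)            ∎)
    where open ≡-Reasoning

  length-prefix⁺ : ∀ P → length P ≡ suc j → length (P ++ b₁ ∷ b') ≡ n
  length-prefix⁺ P len = begin
    length (P ++ b₁ ∷ b')          ≡⟨ length-++ P ⟩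
    length P + length (b₁ ∷ b')    ≡⟨ cong₂ _+_ len length-b ⟩
    suc j + (n ∸ suc j)            ≡⟨ m+[n∸m]≡n k≤n ⟩
    n                              ∎
    where open ≡-Reasoning

  0<length : ∀ (P : List ℕ) → length P ≡ suc j → 0 < length P
  0<length P len = subst (0 <_) (sym len) (s≤s z≤n)

  private
    witness : List ℕ
    witness = proj₁ (proj₁ μ)

    witness-valid : InR n (witness ++ b₁ ∷ b')
    witness-valid = proj₁ (proj₂ (proj₁ μ))

    length-witness : length witness ≡ suc j
    length-witness = length-prefix⁻ witness (proj₁ witness-valid)

    witness-split : IsRG witness × RGFrom (maxL witness) (b₁ ∷ b')
    witness-split = IsRG-++⁻ witness (b₁ ∷ b') (0<length witness length-witness) (proj₂ witness-valid)

    μ≡ : m ≡ maxL witness ⊔ b₁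
    μ≡ = trans (sym (proj₂ (proj₂ (proj₁ μ)))) (maxL-∷ʳ witness b₁)

    maxL-witness≤ : maxL witness ≤ j
    maxL-witness≤ = ≤-pred (subst (maxL witness <_) length-witness
      (IsRG⇒maxL< witness (0<length witness length-witness) (proj₁ witness-split)))

  RGFrom-μ : RGFrom m b'
  RGFrom-μ = subst (λ m → RGFrom m b') (sym μ≡) (proj₂ (proj₂ witness-split))

  b₁≤k : b₁ ≤ suc j
  b₁≤k = ≤-trans (proj₁ (proj₂ witness-split)) (s≤s maxL-witness≤)

  b₁≤μ : b₁ ≤ m
  b₁≤μ = subst (b₁ ≤_) (sym μ≡) (m≤n⊔m (maxL witness) b₁)

  μ≤j⊔b₁ : m ≤ j ⊔ b₁
  μ≤j⊔b₁ = subst (_≤ j ⊔ b₁) (sym μ≡) (⊔-monoˡ-≤ b₁ maxL-witness≤)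

  prefix-compatible⁻ : ∀ P → InR n (P ++ b₁ ∷ b') → CompatiblePrefix m b₁ P
  prefix-compatible⁻ P valid with IsRG-++⁻ P (b₁ ∷ b') (0<length P (length-prefix⁻ P (proj₁ valid))) (proj₂ valid)
  ... | rgP , (b₁≤ , _) = rgP , b₁≤ , subst (m ≤_) (maxL-∷ʳ P b₁) (proj₂ μ P valid)

  prefix-compatible⁺ : ∀ P → length P ≡ suc j → CompatiblePrefix m b₁ P → InR n (P ++ b₁ ∷ b')
  prefix-compatible⁺ P len (rgP , b₁≤ , μ≤) =
    length-prefix⁺ P len ,
    IsRG-++⁺ P (b₁ ∷ b') (0<length P len) rgP (b₁≤ , RGFrom-mono b' μ≤ RGFrom-μ)

  alphaR⇔compatible : ∀ x →
    alphaR n (b₁ ∷ b') x ⇔ Σ (List ℕ) (λ q → length q ≡ j × CompatiblePrefix m b₁ (q ∷ʳ x))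
  alphaR⇔compatible x = mk⇔ to from
    where
    to : alphaR n (b₁ ∷ b') x → Σ (List ℕ) (λ q → length q ≡ j × CompatiblePrefix m b₁ (q ∷ʳ x))
    to (q , valid) = q , length-q , prefix-compatible⁻ (q ∷ʳ x) valid′
      where
      valid′ : InR n (q ∷ʳ x ++ b₁ ∷ b')
      valid′ = subst (InR n) (sym (∷ʳ-++ q x (b₁ ∷ b'))) valid
      length-q : length q ≡ j
      length-q = suc-injective (trans (sym (length-∷ʳ q x)) (length-prefix⁻ (q ∷ʳ x) (proj₁ valid′)))
    from : Σ (List ℕ) (λ q → length q ≡ j × CompatiblePrefix m b₁ (q ∷ʳ x)) → alphaR n (b₁ ∷ b') x
    from (q , length-q , compat) = q , subst (InR n) (∷ʳ-++ q x (b₁ ∷ b'))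
      (prefix-compatible⁺ (q ∷ʳ x) (trans (length-∷ʳ q x) (cong suc length-q)) compat)

  alphaR⇒≤ : ∀ x → alphaR n (b₁ ∷ b') x → x ≤ j
  alphaR⇒≤ x a with Equivalence.to (alphaR⇔compatible x) a
  ... | q , refl , (rg , _) = IsRG-∷ʳ⇒≤length q x rg

  alphaR-below⇒ : ∀ x → alphaR n (b₁ ∷ b') x → x < j → m < j ⊎ (m ≡ j × b₁ ≡ j)
  alphaR-below⇒ x a x<j with Equivalence.to (alphaR⇔compatible x) a
  ... | q , refl , (rg , b₁≤ , μ≤) = compatible-below (IsRG-∷ʳ⇒maxL< q x rg x<j) b₁≤ μ≤

  alphaR-staircase : ∀ x → x ≤ j → b₁ ≤ suc (maxL (staircase j ∷ʳ x)) → m ≤ maxL (staircase j ∷ʳ x) ⊔ b₁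
                   → alphaR n (b₁ ∷ b') x
  alphaR-staircase x x≤j b₁≤ μ≤ = Equivalence.from (alphaR⇔compatible x)
    (staircase j , length-staircase j , IsRG-staircase-∷ʳ j x x≤j , b₁≤ , μ≤)

  alphaR-top : alphaR n (b₁ ∷ b') j
  alphaR-top = alphaR-staircase j ≤-refl (≤-trans b₁≤k (s≤s j≤M)) (≤-trans μ≤j⊔b₁ (⊔-monoˡ-≤ b₁ j≤M))
    where
    j≤M : j ≤ maxL (staircase j ∷ʳ j)
    j≤M = ≤-maxL-∷ʳ (staircase j) j

  alphaR-all : (m ≡ j × b₁ ≡ j) ⊎ m < j → ∀ x → x ≤ j → alphaR n (b₁ ∷ b') x
  alphaR-all cond x x≤j = alphaR-staircase x x≤j (b₁≤ cond) (μ≤ cond)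
    where
    M : ℕ
    M = maxL (staircase j ∷ʳ x)
    j≤1+M : j ≤ suc M
    j≤1+M = ≤-trans (≤-suc-maxL-staircase j) (s≤s (maxL-≤-maxL-∷ʳ (staircase j) x))
    b₁≤ : (m ≡ j × b₁ ≡ j) ⊎ m < j → b₁ ≤ suc M
    b₁≤ (inj₁ (_ , refl)) = j≤1+M
    b₁≤ (inj₂ m<j)        = ≤-trans b₁≤μ (≤-trans (<⇒≤ m<j) j≤1+M)
    μ≤ : (m ≡ j × b₁ ≡ j) ⊎ m < j → m ≤ M ⊔ b₁
    μ≤ (inj₁ (m≡j , b₁≡j)) = subst (_≤ M ⊔ b₁) (trans b₁≡j (sym m≡j)) (m≤n⊔m M b₁)
    μ≤ (inj₂ m<j)          = ≤-trans (≤-pred (≤-trans m<j j≤1+M)) (m≤m⊔n M b₁)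

proposition9 :
    ((n k : ℕ) (b₁ : ℕ) (b' : List ℕ) → 1 ≤ k → k < n
      → length (b₁ ∷ b') ≡ n ∸ k → Admissible n (b₁ ∷ b')
      → (m : ℕ) → IsMuR n b₁ b' m
      → ((m ≡ k ⊎ (m ≡ k ∸ 1 × b₁ < k ∸ 1))
           → (x : ℕ) → alphaR n (b₁ ∷ b') x ⇔ x ≡ k ∸ 1)
        × (((m ≡ k ∸ 1 × b₁ ≡ k ∸ 1) ⊎ m < k ∸ 1)
           → (x : ℕ) → alphaR n (b₁ ∷ b') x ⇔ x ≤ k ∸ 1))
    × ((n x : ℕ) → 1 ≤ n → alphaR n [] x ⇔ x ≤ n ∸ 1)
proposition9 = nonempty , empty
  where
  nonempty : (n k : ℕ) (b₁ : ℕ) (b' : List ℕ) → 1 ≤ k → k < n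
    → length (b₁ ∷ b') ≡ n ∸ k → Admissible n (b₁ ∷ b')
    → (m : ℕ) → IsMuR n b₁ b' m
    → ((m ≡ k ⊎ (m ≡ k ∸ 1 × b₁ < k ∸ 1)) → (x : ℕ) → alphaR n (b₁ ∷ b') x ⇔ x ≡ k ∸ 1)
    × (((m ≡ k ∸ 1 × b₁ ≡ k ∸ 1) ⊎ m < k ∸ 1) → (x : ℕ) → alphaR n (b₁ ∷ b') x ⇔ x ≤ k ∸ 1)
  nonempty n (suc j) b₁ b' _ k<n length-b _ m μ = singleton , interval
    where
    open Suffix (<⇒≤ k<n) length-b μ
    singleton : m ≡ suc j ⊎ (m ≡ j × b₁ < j) → (x : ℕ) → alphaR n (b₁ ∷ b') x ⇔ x ≡ j
    singleton cond x = mk⇔ to (λ { refl → alphaR-top })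
      where
      to : alphaR n (b₁ ∷ b') x → x ≡ j
      to a with m≤n⇒m<n∨m≡n (alphaR⇒≤ x a)
      ... | inj₂ x≡j = x≡j
      ... | inj₁ x<j = ⊥-elim (singleton-case-excludes cond (alphaR-below⇒ x a x<j))
    interval : (m ≡ j × b₁ ≡ j) ⊎ m < j → (x : ℕ) → alphaR n (b₁ ∷ b') x ⇔ x ≤ j
    interval cond x = mk⇔ (alphaR⇒≤ x) (alphaR-all cond x)

  empty : (n x : ℕ) → 1 ≤ n → alphaR n [] x ⇔ x ≤ n ∸ 1
  empty (suc n) x _ = mk⇔ ≤-pred s≤s
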